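{- Let $L\ge1$ be an integer and define power series $F_r^L(x)$ by $F_0^L=1$ and $rF_r^L(x)=\frac12\sum_{k=1}^{\min(r,L)}kC_k(x)F_{r-k}^L(x)$ for $r\ge1$. Then for every $r\ge0$ there are constants $f^L_{r,d}$ such that, for $|x|<e^{ -1}$, $$F_r^L(x)=\sum_{d=0}^{5r}\frac{f_{r,d}^L}{(1-T(x))^{3r-d}},$$ and, writing $f_r^L=f_{r,0}^L$ and $g_r^L=-f_{r,1}^L$, $$\frac{f_r^L}{(1-T(x))^{3r}}-\frac{g_r^L}{(1-T(x))^{3r-1}}\le_c F_r^L(x)\le_c\frac{f_r^L}{(1-T(x))^{3r}}.$$ Moreover $f_0^L=1$, $g_0^L=0$, and for $r\ge1$ $$rf_r^L=\frac12\sum_{k=1}^{\min(r,L)}k\,c_k\,f_{r-k}^L,\qquad rg_r^L=\frac12\sum_{k=1}^{\min(r,L)}k\,c_k\,g_{r-k}^L+\frac12\sum_{k=1}^{\min(r,L)}k\,d_k\,f_{r-k}^L;$$ in particular $f_r^L>0$ and $g_r^L>0$ for $r>0$.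
   Context: $C_\ell(x)=\sum_{k\ge1}C(k,k+\ell)x^k/k!$, where $C(k,k+\ell)$ is the number of connected graphs on $[k]$ with $k+\ell$ edges. $T(x)=\sum_{k\ge1}k^{k-1}x^k/k!$ is the tree function (radius of convergence $e^{ -1}$, $T(x)=xe^{T(x)}$). It is known (Wright) that for $\ell\ge1$ and $|x|<e^{ -1}$, $C_\ell(x)=\sum_{d=0}^{3\ell+2}c_{\ell,d}(1-T(x))^{ -(3\ell-d)}$ for certain constants $c_{\ell,d}$, and that with $c_\ell:=c_{\ell,0}>0$, $d_\ell:=-c_{\ell,1}>0$ one has $\frac{c_\ell}{(1-T(x))^{3\ell}}-\frac{d_\ell}{(1-T(x))^{3\ell-1}}\le_c C_\ell(x)\le_c\frac{c_\ell}{(1-T(x))^{3\ell}}$. Here each $(1-T(x))^{ -j}$ is regarded as a power series in $x$, and $\sum_ja_jx^j\le_c\sum_jb_jx^j$ means $a_j\le b_j$ for all $j$. -}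

module Defs where

open import Data.Bool using (Bool; true; false)
open import Data.Nat as ℕ using (ℕ; zero; suc; _∸_; _≤_; _<_; _<?_)
open import Data.Nat.Properties using (_!≢0)
open import Data.Integer as ℤ using (ℤ; +_; -[1+_])
open import Data.Rational as ℚ using (ℚ; 0ℚ; 1ℚ; ½; _/_)
open import Data.Fin using (Fin; toℕ)
open import Data.Vec using (Vec; lookup)
open import Data.List using (List; []; _∷_; length; filter; allFin; concatMap; map)
open import Data.List.Relation.Unary.Unique.Propositional using (Unique)
open import Data.List.Membership.Propositional using (_∈_)
open import Data.Product using (_×_; _,_; ∃; proj₁; proj₂)
open import Data.Bool.Properties using () renaming (_≟_ to _≟ᵇ_)
open import Relation.Nullary.Decidable using (_×-dec_)
open import Relation.Binary.PropositionalEquality using (_≡_)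
open import Relation.Binary.Construct.Closure.ReflexiveTransitive using (Star)
open import Function.Bundles using (_⇔_)

Graph : ℕ → Set
Graph k = Vec (Vec Bool k) k

Adj : ∀ {k} → Graph k → Fin k → Fin k → Set
Adj G i j = lookup (lookup G i) j ≡ true

Simple : ∀ {k} → Graph k → Set
Simple {k} G = (∀ (i : Fin k) → lookup (lookup G i) i ≡ false)
             × (∀ (i j : Fin k) → lookup (lookup G i) j ≡ lookup (lookup G j) i)

Connected : ∀ {k} → Graph k → Set
Connected {k} G = ∀ (u v : Fin k) → Star (Adj G) u v

allPairs : (k : ℕ) → List (Fin k × Fin k)
allPairs k = concatMap (λ i → map (λ j → (i , j)) (allFin k)) (allFin k)

edgeCount : ∀ {k} → Graph k → ℕ
edgeCount {k} G = length (filter (λ p → (toℕ (proj₁ p) <? toℕ (proj₂ p))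
                                   ×-dec (lookup (lookup G (proj₁ p)) (proj₂ p) ≟ᵇ true))
                                 (allPairs k))

-- "N is the number of connected simple graphs on [k] with m edges":
-- there is a duplicate-free list enumerating exactly these graphs, of length N.
IsConnectedGraphCount : ℕ → ℕ → ℕ → Set
IsConnectedGraphCount N k m =
  ∃ λ (xs : List (Graph k)) →
      Unique xs
    × (∀ (G : Graph k) → (G ∈ xs) ⇔ (Simple G × Connected G × edgeCount G ≡ m))
    × length xs ≡ N

PS : Set
PS = ℕ → ℚ

Σ< : ℕ → (ℕ → ℚ) → ℚ
Σ< zero    g = 0ℚ
Σ< (suc n) g = Σ< n g ℚ.+ g n

Σ1to : ℕ → (ℕ → ℚ) → ℚ
Σ1to n g = Σ< n (λ j → g (suc j))

nat : ℕ → ℚ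
nat n = + n / 1

oneS : PS
oneS zero    = 1ℚ
oneS (suc _) = 0ℚ

_+S_ : PS → PS → PS
(a +S b) n = a n ℚ.+ b n

_-S_ : PS → PS → PS
(a -S b) n = a n ℚ.- b n

_·S_ : ℚ → PS → PS
(q ·S a) n = q ℚ.* a n

_*S_ : PS → PS → PS
(a *S b) n = Σ< (suc n) (λ i → a i ℚ.* b (n ∸ i))

_^S_ : PS → ℕ → PS
a ^S zero  = oneS
a ^S suc m = a *S (a ^S m)

ΣS : ℕ → (ℕ → PS) → PS
ΣS D g n = Σ< D (λ d → g d n)

_≈S_ : PS → PS → Set
a ≈S b = ∀ n → a n ≡ b n

_≤c_ : PS → PS → Set
a ≤c b = ∀ n → a n ℚ.≤ b n

T : PS
T zero    = 0ℚ
T (suc k) = (+ (suc k ℕ.^ k) / (suc k ℕ.!)) {{suc k !≢0}}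

oneMinusT : PS
oneMinusT = oneS -S T

-- (1 - T)^(-1) = Σ_{j ≥ 0} T^j  (finite in each coefficient since T(0)=0)
invOneMinusT : PS
invOneMinusT n = Σ< (suc n) (λ j → (T ^S j) n)

-- (1 - T(x))^(-e) for an integer exponent e
negPow : ℤ → PS
negPow (+ n)      = invOneMinusT ^S n
negPow -[1+ n ]   = oneMinusT ^S (suc n)

-- C_ℓ(x) = Σ_{k ≥ 1} C(k, k+ℓ) x^k / k!, for a given graph-count function Cnt

Cser : (ℕ → ℕ → ℕ) → ℕ → PS
Cser Cnt ℓ zero    = 0ℚ
Cser Cnt ℓ (suc k) = (+ Cnt (suc k) (suc k ℕ.+ ℓ) / (suc k ℕ.!)) {{suc k !≢0}}

ΣS1to : ℕ → (ℕ → PS) → PS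
ΣS1to D g = ΣS D (λ j → g (suc j))

-- Write X = (1 - T)⁻¹. By strong induction on r, F_r is a Laurent polynomial in X with exponents
-- 3r, 3r - 1, …, -2r: in the recurrence, C_k has exponents 3k, …, -2 and F_{r-k} has exponents
-- 3(r-k), …, -2(r-k), and X^a X^b = X^(a+b) because (1 - T)(1 - T)⁻¹ = 1. The coefficients f_{r,d} thus
-- satisfy the recurrence of F_r with C_k replaced by its coefficient sequence and products by convolutions
-- in d; at d = 0 and d = 1 this is the recurrence for f_r and g_r, whence their positivity. For the bounds,
-- every series involved has nonnegative coefficients, so multiplying the bounds for C_k by those for F_{r-k}
-- (whose subleading part g_{r-k} X^{3(r-k)-1} is again nonnegative) and summing preserves ≤_c.

module Submission where

open import Data.Nat as ℕ using (ℕ; zero; suc; z≤n; s≤s; _∸_; _⊓_)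
import Data.Nat.Properties as ℕ
open import Data.Integer as ℤ using (ℤ; +_)
import Data.Integer.Properties as ℤ
open import Data.Rational using (ℚ; 0ℚ; 1ℚ; ½; -_; _<_)
open import Relation.Binary.PropositionalEquality

open import Defs

module Rationals where

  open import Data.Rational using (_*_; _≤_; 1/_; NonZero)
  open import Data.Rational.Base using (nonNegative; positive)
  open import Data.Rational.Properties
  open import Relation.Nullary.Decidable using (dec⇒maybe)
  open import Tactic.RingSolver.Core.AlmostCommutativeRing
    using (AlmostCommutativeRing; fromCommutativeRing)

  ℚ-ring : AlmostCommutativeRing _ _
  ℚ-ring = fromCommutativeRing +-*-commutativeRing (λ x → dec⇒maybe (0ℚ ≟ x))

  *-nonNeg : ∀ {p q} → 0ℚ ≤ p → 0ℚ ≤ q → 0ℚ ≤ p * q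
  *-nonNeg {p} {q} 0≤p 0≤q =
    nonNegative⁻¹ (p * q) {{nonNeg*nonNeg⇒nonNeg p {{nonNegative 0≤p}} q {{nonNegative 0≤q}}}}

  *-pos : ∀ {p q} → 0ℚ < p → 0ℚ < q → 0ℚ < p * q
  *-pos {p} {q} 0<p 0<q = positive⁻¹ (p * q) {{pos*pos⇒pos p {{positive 0<p}} q {{positive 0<q}}}}

  *-monoˡ-≤-0≤ : ∀ {r p q} → 0ℚ ≤ r → p ≤ q → r * p ≤ r * q
  *-monoˡ-≤-0≤ {r} 0≤r = *-monoˡ-≤-nonNeg r {{nonNegative 0≤r}}

  *-monoʳ-≤-0≤ : ∀ {r p q} → 0ℚ ≤ r → p ≤ q → p * r ≤ q * r
  *-monoʳ-≤-0≤ {r} 0≤r = *-monoʳ-≤-nonNeg r {{nonNegative 0≤r}}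

  nat-suc-pos : ∀ r → 0ℚ < nat (suc r)
  nat-suc-pos r = positive⁻¹ (nat (suc r)) {{normalize-pos (suc r) 1}}

  nat-suc-nonZero : ∀ r → NonZero (nat (suc r))
  nat-suc-nonZero r = pos⇒nonZero (nat (suc r)) {{normalize-pos (suc r) 1}}

  1/suc : ℕ → ℚ
  1/suc r = (1/ nat (suc r)) {{nat-suc-nonZero r}}

  1/suc-pos : ∀ r → 0ℚ < 1/suc r
  1/suc-pos r = positive⁻¹ _ {{1/pos⇒pos (nat (suc r)) {{normalize-pos (suc r) 1}}}}

  1/suc-cancel : ∀ r x → 1/suc r * (nat (suc r) * x) ≡ x
  1/suc-cancel r x = begin
    1/suc r * (nat (suc r) * x)    ≡⟨ *-assoc (1/suc r) (nat (suc r)) x ⟨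
    (1/suc r * nat (suc r)) * x    ≡⟨ cong (_* x) (*-inverseˡ (nat (suc r)) {{nat-suc-nonZero r}}) ⟩
    1ℚ * x                         ≡⟨ *-identityˡ x ⟩
    x                              ∎
    where open ≡-Reasoning

  nat-suc-cancel : ∀ r x → nat (suc r) * (1/suc r * x) ≡ x
  nat-suc-cancel r x = begin
    nat (suc r) * (1/suc r * x)    ≡⟨ *-assoc (nat (suc r)) (1/suc r) x ⟨
    (nat (suc r) * 1/suc r) * x    ≡⟨ cong (_* x) (*-inverseʳ (nat (suc r)) {{nat-suc-nonZero r}}) ⟩
    1ℚ * x                         ≡⟨ *-identityˡ x ⟩
    x                              ∎
    where open ≡-Reasoning

module FiniteSums where

  open import Data.Rational using (_+_; _*_; _≤_)
  open import Data.Rational.Properties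
  open import Data.Sum using (inj₁; inj₂)
  open import Tactic.RingSolver using (solve-∀)

  open Rationals

  Σ<-cong : ∀ n {g h : ℕ → ℚ} → (∀ i → i ℕ.< n → g i ≡ h i) → Σ< n g ≡ Σ< n h
  Σ<-cong zero    eq = refl
  Σ<-cong (suc n) eq =
    cong₂ _+_ (Σ<-cong n (λ i i<n → eq i (ℕ.m<n⇒m<1+n i<n))) (eq n (ℕ.n<1+n n))

  Σ<-zero : ∀ n {g : ℕ → ℚ} → (∀ i → i ℕ.< n → g i ≡ 0ℚ) → Σ< n g ≡ 0ℚ
  Σ<-zero zero    eq = refl
  Σ<-zero (suc n) eq rewrite Σ<-zero n (λ i i<n → eq i (ℕ.m<n⇒m<1+n i<n))
                           | eq n (ℕ.n<1+n n) = refl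

  Σ<-distrib-+ : ∀ n (g h : ℕ → ℚ) → Σ< n (λ i → g i + h i) ≡ Σ< n g + Σ< n h
  Σ<-distrib-+ zero    g h = refl
  Σ<-distrib-+ (suc n) g h rewrite Σ<-distrib-+ n g h = swap (Σ< n g) (Σ< n h) (g n) (h n)
    where
    swap : ∀ a b c d → (a + b) + (c + d) ≡ (a + c) + (b + d)
    swap = solve-∀ ℚ-ring

  Σ<-*ˡ : ∀ n q (g : ℕ → ℚ) → q * Σ< n g ≡ Σ< n (λ i → q * g i)
  Σ<-*ˡ zero    q g = *-zeroʳ q
  Σ<-*ˡ (suc n) q g rewrite sym (Σ<-*ˡ n q g) = *-distribˡ-+ q (Σ< n g) (g n)

  Σ<-*ʳ : ∀ n q (g : ℕ → ℚ) → Σ< n g * q ≡ Σ< n (λ i → g i * q)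
  Σ<-*ʳ n q g = trans (*-comm (Σ< n g) q)
    (trans (Σ<-*ˡ n q g) (Σ<-cong n (λ i _ → *-comm q (g i))))

  Σ<-neg : ∀ n (g : ℕ → ℚ) → - Σ< n g ≡ Σ< n (λ i → - g i)
  Σ<-neg zero    g = refl
  Σ<-neg (suc n) g rewrite sym (Σ<-neg n g) = neg-distrib-+ (Σ< n g) (g n)

  Σ<-suc : ∀ n (g : ℕ → ℚ) → Σ< (suc n) g ≡ g 0 + Σ< n (λ i → g (suc i))
  Σ<-suc zero    g = trans (+-identityˡ (g 0)) (sym (+-identityʳ (g 0)))
  Σ<-suc (suc n) g rewrite Σ<-suc n g = +-assoc (g 0) _ _

  Σ<-swap : ∀ m n (h : ℕ → ℕ → ℚ) →
            Σ< m (λ i → Σ< n (h i)) ≡ Σ< n (λ j → Σ< m (λ i → h i j))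
  Σ<-swap zero    n h = sym (Σ<-zero n (λ _ _ → refl))
  Σ<-swap (suc m) n h rewrite Σ<-swap m n h = sym (Σ<-distrib-+ n (λ j → Σ< m (λ i → h i j)) (h m))

  Σ<-extend : ∀ m M (g : ℕ → ℚ) → m ℕ.≤ M → (∀ j → m ℕ.≤ j → j ℕ.< M → g j ≡ 0ℚ) →
              Σ< m g ≡ Σ< M g
  Σ<-extend m zero    g z≤n vanish = refl
  Σ<-extend m (suc M) g m≤ vanish with ℕ.m≤n⇒m<n∨m≡n m≤
  ... | inj₂ refl = refl
  ... | inj₁ (s≤s m≤M) = begin
    Σ< m g             ≡⟨ Σ<-extend m M g m≤M (λ j m≤j j<M → vanish j m≤j (ℕ.m<n⇒m<1+n j<M)) ⟩
    Σ< M g             ≡⟨ sym (+-identityʳ (Σ< M g)) ⟩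
    Σ< M g + 0ℚ        ≡⟨ cong (λ z → Σ< M g + z) (sym (vanish M m≤M (ℕ.n<1+n M))) ⟩
    Σ< M g + g M       ∎
    where open ≡-Reasoning

  Σ<-reverse : ∀ n (g : ℕ → ℚ) → Σ< n g ≡ Σ< n (λ i → g (n ∸ suc i))
  Σ<-reverse zero    g = refl
  Σ<-reverse (suc n) g rewrite Σ<-suc n (λ i → g (n ∸ i)) | sym (Σ<-reverse n g) =
    +-comm (Σ< n g) (g n)

  Σ<-triangle : ∀ N (H : ℕ → ℕ → ℚ) →
    Σ< N (λ i → Σ< (suc i) (λ j → H j i)) ≡ Σ< N (λ j → Σ< (N ∸ j) (λ m → H j (j ℕ.+ m)))
  Σ<-triangle zero    H = refl
  Σ<-triangle (suc N) H = begin
    Σ< N (λ i → Σ< (suc i) (λ j → H j i)) + Σ< (suc N) (λ j → H j N)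
      ≡⟨ cong (_+ Σ< (suc N) (λ j → H j N)) (trans (Σ<-triangle N H) rows-N) ⟩
    Σ< (suc N) row + Σ< (suc N) (λ j → H j N)
      ≡⟨ sym (Σ<-distrib-+ (suc N) row (λ j → H j N)) ⟩
    Σ< (suc N) (λ j → row j + H j N)
      ≡⟨ Σ<-cong (suc N) extend-row ⟩
    Σ< (suc N) (λ j → Σ< (suc N ∸ j) (λ m → H j (j ℕ.+ m)))
    ∎
    where
    open ≡-Reasoning
    row : ℕ → ℚ
    row j = Σ< (N ∸ j) (λ m → H j (j ℕ.+ m))
    rows-N : Σ< N row ≡ Σ< (suc N) row
    rows-N rewrite ℕ.n∸n≡0 N = sym (+-identityʳ (Σ< N row))
    extend-row : ∀ j → j ℕ.< suc N → row j + H j N ≡ Σ< (suc N ∸ j) (λ m → H j (j ℕ.+ m))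
    extend-row j (s≤s j≤N) rewrite ℕ.+-∸-assoc 1 j≤N =
      cong (λ z → row j + z) (cong (H j) (sym (ℕ.m+[n∸m]≡n j≤N)))

  Σ<-mono-≤ : ∀ n {g h : ℕ → ℚ} → (∀ i → i ℕ.< n → g i ≤ h i) → Σ< n g ≤ Σ< n h
  Σ<-mono-≤ zero    le = ≤-refl
  Σ<-mono-≤ (suc n) le =
    +-mono-≤ (Σ<-mono-≤ n (λ i i<n → le i (ℕ.m<n⇒m<1+n i<n))) (le n (ℕ.n<1+n n))

  Σ<-nonNeg : ∀ n {g : ℕ → ℚ} → (∀ i → i ℕ.< n → 0ℚ ≤ g i) → 0ℚ ≤ Σ< n g
  Σ<-nonNeg n {g} nonNeg =
    subst (_≤ Σ< n g) (Σ<-zero n (λ _ _ → refl)) (Σ<-mono-≤ n nonNeg)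

  Σ<-pos : ∀ n {g : ℕ → ℚ} → (∀ i → i ℕ.< suc n → 0ℚ < g i) → 0ℚ < Σ< (suc n) g
  Σ<-pos n pos =
    +-mono-≤-< (Σ<-nonNeg n (λ i i<n → <⇒≤ (pos i (ℕ.m<n⇒m<1+n i<n)))) (pos n (ℕ.n<1+n n))

module PowerSeries where

  open import Data.Rational using (_+_; _*_; _-_; _≤_)
  open import Data.Rational.Properties
  open import Tactic.RingSolver using (solve-∀)

  open Rationals
  open FiniteSums

  ≈S-refl : ∀ {a} → a ≈S a
  ≈S-refl n = refl

  ≈S-sym : ∀ {a b} → a ≈S b → b ≈S a
  ≈S-sym a≈b n = sym (a≈b n)

  ≈S-trans : ∀ {a b c} → a ≈S b → b ≈S c → a ≈S c
  ≈S-trans a≈b b≈c n = trans (a≈b n) (b≈c n)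

  *S-cong : ∀ {a a′ b b′} → a ≈S a′ → b ≈S b′ → (a *S b) ≈S (a′ *S b′)
  *S-cong a≈a′ b≈b′ n = Σ<-cong (suc n) (λ i _ → cong₂ _*_ (a≈a′ i) (b≈b′ (n ∸ i)))

  *S-comm : ∀ a b → (a *S b) ≈S (b *S a)
  *S-comm a b n = trans (Σ<-reverse (suc n) (λ i → a i * b (n ∸ i)))
    (Σ<-cong (suc n) (λ i i≤n → trans
      (cong (λ m → a (n ∸ i) * b m) (ℕ.m∸[m∸n]≡n (ℕ.≤-pred i≤n)))
      (*-comm (a (n ∸ i)) (b i))))

  *S-assoc : ∀ a b c → ((a *S b) *S c) ≈S (a *S (b *S c))
  *S-assoc a b c n = begin
    Σ< (suc n) (λ i → Σ< (suc i) (λ j → a j * b (i ∸ j)) * c (n ∸ i))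
      ≡⟨ Σ<-cong (suc n) (λ i _ → Σ<-*ʳ (suc i) (c (n ∸ i)) (λ j → a j * b (i ∸ j))) ⟩
    Σ< (suc n) (λ i → Σ< (suc i) (λ j → (a j * b (i ∸ j)) * c (n ∸ i)))
      ≡⟨ Σ<-triangle (suc n) (λ j i → (a j * b (i ∸ j)) * c (n ∸ i)) ⟩
    Σ< (suc n) (λ j → Σ< (suc n ∸ j) (λ m → (a j * b ((j ℕ.+ m) ∸ j)) * c (n ∸ (j ℕ.+ m))))
      ≡⟨ Σ<-cong (suc n) inner ⟩
    Σ< (suc n) (λ j → a j * Σ< (suc (n ∸ j)) (λ m → b m * c ((n ∸ j) ∸ m)))
    ∎
    where
    open ≡-Reasoning
    inner : ∀ j → j ℕ.< suc n →
      Σ< (suc n ∸ j) (λ m → (a j * b ((j ℕ.+ m) ∸ j)) * c (n ∸ (j ℕ.+ m)))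
        ≡ a j * Σ< (suc (n ∸ j)) (λ m → b m * c ((n ∸ j) ∸ m))
    inner j (s≤s j≤n) rewrite ℕ.+-∸-assoc 1 j≤n = trans
      (Σ<-cong (suc (n ∸ j)) (λ m _ → trans
        (cong₂ (λ x y → (a j * b x) * c y) (ℕ.m+n∸m≡n j m) (sym (ℕ.∸-+-assoc n j m)))
        (*-assoc (a j) (b m) (c ((n ∸ j) ∸ m)))))
      (sym (Σ<-*ˡ (suc (n ∸ j)) (a j) (λ m → b m * c ((n ∸ j) ∸ m))))

  *S-identityˡ : ∀ a → (oneS *S a) ≈S a
  *S-identityˡ a n = begin
    Σ< (suc n) (λ i → oneS i * a (n ∸ i))
      ≡⟨ Σ<-suc n (λ i → oneS i * a (n ∸ i)) ⟩
    1ℚ * a n + Σ< n (λ i → 0ℚ * a (n ∸ suc i))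
      ≡⟨ cong₂ _+_ (*-identityˡ (a n)) (Σ<-zero n (λ i _ → *-zeroˡ (a (n ∸ suc i)))) ⟩
    a n + 0ℚ
      ≡⟨ +-identityʳ (a n) ⟩
    a n
    ∎
    where open ≡-Reasoning

  *S-identityʳ : ∀ a → (a *S oneS) ≈S a
  *S-identityʳ a = ≈S-trans (*S-comm a oneS) (*S-identityˡ a)

  *S-distribʳ-sub : ∀ a b c → ((b -S c) *S a) ≈S ((b *S a) -S (c *S a))
  *S-distribʳ-sub a b c n = begin
    Σ< (suc n) (λ i → (b i - c i) * a (n ∸ i))
      ≡⟨ Σ<-cong (suc n) (λ i _ → distrib (b i) (c i) (a (n ∸ i))) ⟩
    Σ< (suc n) (λ i → b i * a (n ∸ i) + - (c i * a (n ∸ i)))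
      ≡⟨ Σ<-distrib-+ (suc n) _ _ ⟩
    (b *S a) n + Σ< (suc n) (λ i → - (c i * a (n ∸ i)))
      ≡⟨ cong (λ z → (b *S a) n + z) (sym (Σ<-neg (suc n) _)) ⟩
    (b *S a) n - (c *S a) n
    ∎
    where
    open ≡-Reasoning
    distrib : ∀ x y z → (x - y) * z ≡ x * z + - (y * z)
    distrib = solve-∀ ℚ-ring

  *S-distribˡ-sub : ∀ a b c → (a *S (b -S c)) ≈S ((a *S b) -S (a *S c))
  *S-distribˡ-sub a b c n = begin
    (a *S (b -S c)) n                 ≡⟨ *S-comm a (b -S c) n ⟩
    ((b -S c) *S a) n                 ≡⟨ *S-distribʳ-sub a b c n ⟩
    (b *S a) n - (c *S a) n           ≡⟨ cong₂ _-_ (*S-comm b a n) (*S-comm c a n) ⟩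
    (a *S b) n - (a *S c) n           ∎
    where open ≡-Reasoning

  ·S-*S-·S : ∀ p q a b → ((p ·S a) *S (q ·S b)) ≈S ((p * q) ·S (a *S b))
  ·S-*S-·S p q a b n = trans
    (Σ<-cong (suc n) (λ i _ → interchange p (a i) q (b (n ∸ i))))
    (sym (Σ<-*ˡ (suc n) (p * q) (λ i → a i * b (n ∸ i))))
    where
    interchange : ∀ x y z w → (x * y) * (z * w) ≡ (x * z) * (y * w)
    interchange = solve-∀ ℚ-ring

  *S-distribˡ-ΣS : ∀ N a (g : ℕ → PS) → (a *S ΣS N g) ≈S ΣS N (λ d → a *S g d)
  *S-distribˡ-ΣS N a g n = trans
    (Σ<-cong (suc n) (λ i _ → Σ<-*ˡ N (a i) (λ d → g d (n ∸ i))))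
    (Σ<-swap (suc n) N (λ i d → a i * g d (n ∸ i)))

  *S-distribʳ-ΣS : ∀ N a (g : ℕ → PS) → (ΣS N g *S a) ≈S ΣS N (λ d → g d *S a)
  *S-distribʳ-ΣS N a g n = begin
    (ΣS N g *S a) n                  ≡⟨ *S-comm (ΣS N g) a n ⟩
    (a *S ΣS N g) n                  ≡⟨ *S-distribˡ-ΣS N a g n ⟩
    Σ< N (λ d → (a *S g d) n)        ≡⟨ Σ<-cong N (λ d _ → *S-comm a (g d) n) ⟩
    Σ< N (λ d → (g d *S a) n)        ∎
    where open ≡-Reasoning

  ^S-+ : ∀ a m n → ((a ^S m) *S (a ^S n)) ≈S (a ^S (m ℕ.+ n))
  ^S-+ a zero    n = *S-identityˡ (a ^S n)
  ^S-+ a (suc m) n = ≈S-trans (*S-assoc a (a ^S m) (a ^S n)) (*S-cong {a} ≈S-refl (^S-+ a m n))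

  *S-interchange : ∀ a b c d → ((a *S b) *S (c *S d)) ≈S ((a *S c) *S (b *S d))
  *S-interchange a b c d n = begin
    ((a *S b) *S (c *S d)) n      ≡⟨ *S-assoc a b (c *S d) n ⟩
    (a *S (b *S (c *S d))) n      ≡⟨ *S-cong {a} {a} {b *S (c *S d)} ≈S-refl middle n ⟩
    (a *S (c *S (b *S d))) n      ≡⟨ *S-assoc a c (b *S d) n ⟨
    ((a *S c) *S (b *S d)) n      ∎
    where
    open ≡-Reasoning
    middle : (b *S (c *S d)) ≈S (c *S (b *S d))
    middle = ≈S-trans (≈S-sym (*S-assoc b c d))
      (≈S-trans (*S-cong {b *S c} {c *S b} {d} (*S-comm b c) ≈S-refl) (*S-assoc c b d))

  NonNegS : PS → Set
  NonNegS a = ∀ n → 0ℚ ≤ a n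

  oneS-nonNeg : NonNegS oneS
  oneS-nonNeg zero    = nonNegative⁻¹ 1ℚ
  oneS-nonNeg (suc n) = ≤-refl

  *S-nonNeg : ∀ {a b} → NonNegS a → NonNegS b → NonNegS (a *S b)
  *S-nonNeg 0≤a 0≤b n = Σ<-nonNeg (suc n) (λ i _ → *-nonNeg (0≤a i) (0≤b (n ∸ i)))

  ^S-nonNeg : ∀ {a} m → NonNegS a → NonNegS (a ^S m)
  ^S-nonNeg zero    0≤a = oneS-nonNeg
  ^S-nonNeg (suc m) 0≤a = *S-nonNeg 0≤a (^S-nonNeg m 0≤a)

  ·S-nonNeg : ∀ {q a} → 0ℚ ≤ q → NonNegS a → NonNegS (q ·S a)
  ·S-nonNeg 0≤q 0≤a n = *-nonNeg 0≤q (0≤a n)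

  *S-monoˡ-≤c : ∀ {a b b′} → NonNegS a → b ≤c b′ → (a *S b) ≤c (a *S b′)
  *S-monoˡ-≤c 0≤a b≤b′ n = Σ<-mono-≤ (suc n) (λ i _ → *-monoˡ-≤-0≤ (0≤a i) (b≤b′ (n ∸ i)))

  *S-monoʳ-≤c : ∀ {a a′ b} → NonNegS b → a ≤c a′ → (a *S b) ≤c (a′ *S b)
  *S-monoʳ-≤c 0≤b a≤a′ n = Σ<-mono-≤ (suc n) (λ i _ → *-monoʳ-≤-0≤ (0≤b (n ∸ i)) (a≤a′ i))

  *S-mono-≤c : ∀ {a a′ b b′} → NonNegS a′ → NonNegS b → a ≤c a′ → b ≤c b′ →
               (a *S b) ≤c (a′ *S b′)
  *S-mono-≤c 0≤a′ 0≤b a≤a′ b≤b′ n =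
    ≤-trans (*S-monoʳ-≤c 0≤b a≤a′ n) (*S-monoˡ-≤c 0≤a′ b≤b′ n)

  *S-lowerBound : ∀ {a b p q u v} → NonNegS a → NonNegS u → NonNegS v →
    (p -S q) ≤c a → a ≤c p → (u -S v) ≤c b →
    (((p -S q) *S u) -S (p *S v)) ≤c (a *S b)
  *S-lowerBound {a} {b} {p} {q} {u} {v} 0≤a 0≤u 0≤v p-q≤a a≤p u-v≤b n = begin
    ((p -S q) *S u) n - (p *S v) n    ≤⟨ +-mono-≤ (*S-monoʳ-≤c 0≤u p-q≤a n)
                                                  (neg-antimono-≤ (*S-monoʳ-≤c 0≤v a≤p n)) ⟩
    (a *S u) n - (a *S v) n           ≡⟨ *S-distribˡ-sub a u v n ⟨
    (a *S (u -S v)) n                 ≤⟨ *S-monoˡ-≤c 0≤a u-v≤b n ⟩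
    (a *S b) n                        ∎
    where open ≤-Reasoning

module TreeFunction where

  open import Data.Integer using (-[1+_]; _⊖_)
  open import Data.Rational using (_+_; _*_; _-_)
  open import Data.Rational.Properties
  open import Tactic.RingSolver using (solve-∀)

  open Rationals
  open FiniteSums
  open PowerSeries

  T^-vanishes : ∀ j n → n ℕ.< j → (T ^S j) n ≡ 0ℚ
  T^-vanishes (suc j) n n<1+j = Σ<-zero (suc n) term-vanishes
    where
    term-vanishes : ∀ i → i ℕ.< suc n → T i * (T ^S j) (n ∸ i) ≡ 0ℚ
    term-vanishes zero    _     = *-zeroˡ ((T ^S j) n)
    term-vanishes (suc i) i<1+n = trans
      (cong (T (suc i) *_) (T^-vanishes j (n ∸ suc i)
        (ℕ.<-≤-trans (ℕ.∸-monoʳ-< (s≤s z≤n) (ℕ.≤-pred i<1+n)) (ℕ.≤-pred n<1+j))))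
      (*-zeroʳ (T (suc i)))

  invOneMinusT-unfold : ∀ n → invOneMinusT n ≡ oneS n + (T *S invOneMinusT) n
  invOneMinusT-unfold n = begin
    Σ< (suc n) (λ j → (T ^S j) n)
      ≡⟨ sym (+-identityʳ _) ⟩
    Σ< (suc n) (λ j → (T ^S j) n) + 0ℚ
      ≡⟨ cong (λ z → Σ< (suc n) (λ j → (T ^S j) n) + z) (sym (T^-vanishes (suc n) n (ℕ.n<1+n n))) ⟩
    Σ< (suc (suc n)) (λ j → (T ^S j) n)
      ≡⟨ Σ<-suc (suc n) (λ j → (T ^S j) n) ⟩
    oneS n + Σ< (suc n) (λ j → (T ^S suc j) n)
      ≡⟨ cong (λ z → oneS n + z) (sym T*invOneMinusT) ⟩
    oneS n + (T *S invOneMinusT) n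
    ∎
    where
    open ≡-Reasoning
    T*invOneMinusT : (T *S invOneMinusT) n ≡ Σ< (suc n) (λ j → (T ^S suc j) n)
    T*invOneMinusT = begin
      Σ< (suc n) (λ i → T i * Σ< (suc (n ∸ i)) (λ j → (T ^S j) (n ∸ i)))
        ≡⟨ Σ<-cong (suc n) (λ i _ → cong (T i *_)
             (Σ<-extend (suc (n ∸ i)) (suc n) _ (s≤s (ℕ.m∸n≤m n i))
               (λ j n∸i<j _ → T^-vanishes j (n ∸ i) n∸i<j))) ⟩
      Σ< (suc n) (λ i → T i * Σ< (suc n) (λ j → (T ^S j) (n ∸ i)))
        ≡⟨ Σ<-cong (suc n) (λ i _ → Σ<-*ˡ (suc n) (T i) _) ⟩
      Σ< (suc n) (λ i → Σ< (suc n) (λ j → T i * (T ^S j) (n ∸ i)))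
        ≡⟨ Σ<-swap (suc n) (suc n) _ ⟩
      Σ< (suc n) (λ j → (T ^S suc j) n)
      ∎

  oneMinusT*invOneMinusT : (oneMinusT *S invOneMinusT) ≈S oneS
  oneMinusT*invOneMinusT n = begin
    (oneMinusT *S u) n                    ≡⟨ *S-distribʳ-sub u oneS T n ⟩
    (oneS *S u) n - (T *S u) n            ≡⟨ cong (_- (T *S u) n) (*S-identityˡ u n) ⟩
    u n - (T *S u) n                      ≡⟨ cong (_- (T *S u) n) (invOneMinusT-unfold n) ⟩
    (oneS n + (T *S u) n) - (T *S u) n    ≡⟨ cancel (oneS n) ((T *S u) n) ⟩
    oneS n                                ∎
    where
    open ≡-Reasoning
    u = invOneMinusT
    cancel : ∀ x y → (x + y) - y ≡ x
    cancel = solve-∀ ℚ-ring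

  negPow-⊖ : ∀ a b → ((invOneMinusT ^S a) *S (oneMinusT ^S b)) ≈S negPow (a ⊖ b)
  negPow-⊖ zero    zero    = *S-identityˡ oneS
  negPow-⊖ zero    (suc b) = *S-identityˡ (oneMinusT ^S suc b)
  negPow-⊖ (suc a) zero    = *S-identityʳ (invOneMinusT ^S suc a)
  negPow-⊖ (suc a) (suc b) n = begin
    ((u ^S suc a) *S (w ^S suc b)) n           ≡⟨ *S-interchange u (u ^S a) w (w ^S b) n ⟩
    ((u *S w) *S ((u ^S a) *S (w ^S b))) n     ≡⟨ *S-cong {u *S w} {oneS} {(u ^S a) *S (w ^S b)}
                                                   (≈S-trans (*S-comm u w) oneMinusT*invOneMinusT)
                                                   ≈S-refl n ⟩
    (oneS *S ((u ^S a) *S (w ^S b))) n         ≡⟨ *S-identityˡ ((u ^S a) *S (w ^S b)) n ⟩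
    ((u ^S a) *S (w ^S b)) n                   ≡⟨ negPow-⊖ a b n ⟩
    negPow (a ⊖ b) n                           ≡⟨ cong (λ e → negPow e n) (ℤ.[1+m]⊖[1+n]≡m⊖n a b) ⟨
    negPow (suc a ⊖ suc b) n                   ∎
    where
    open ≡-Reasoning
    u = invOneMinusT
    w = oneMinusT

  negPow-+ : ∀ i j → (negPow i *S negPow j) ≈S negPow (i ℤ.+ j)
  negPow-+ (+ a)    (+ b)    = ^S-+ invOneMinusT a b
  negPow-+ (+ a)    -[1+ b ] = negPow-⊖ a (suc b)
  negPow-+ -[1+ a ] (+ b)    = ≈S-trans (*S-comm (negPow -[1+ a ]) (negPow (+ b))) (negPow-⊖ b (suc a))
  negPow-+ -[1+ a ] -[1+ b ] n =
    trans (^S-+ oneMinusT (suc a) (suc b) n) (cong (λ m → (oneMinusT ^S suc m) n) (ℕ.+-suc a b))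

  negPow-+-≡ : ∀ i j {t} → i ℤ.+ j ≡ t → (negPow i *S negPow j) ≈S negPow t
  negPow-+-≡ i j refl = negPow-+ i j

  T-nonNeg : NonNegS T
  T-nonNeg zero    = ≤-refl
  T-nonNeg (suc k) = nonNegative⁻¹ _ {{normalize-nonNeg (suc k ℕ.^ k) (suc k ℕ.!) {{suc k ℕ.!≢0}}}}

  negPow-nonNeg : ∀ a → NonNegS (negPow (+ a))
  negPow-nonNeg a = ^S-nonNeg a (λ n → Σ<-nonNeg (suc n) (λ j _ → ^S-nonNeg j T-nonNeg n))

  Cser-nonNeg : ∀ Cnt ℓ → NonNegS (Cser Cnt ℓ)
  Cser-nonNeg Cnt ℓ zero    = ≤-refl
  Cser-nonNeg Cnt ℓ (suc k) =
    nonNegative⁻¹ _ {{normalize-nonNeg (Cnt (suc k) (suc k ℕ.+ ℓ)) (suc k ℕ.!) {{suc k ℕ.!≢0}}}}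

module Expansions where

  open import Data.Integer.Tactic.RingSolver as ℤ-Solver using ()
  open import Data.Empty using (⊥-elim)
  open import Data.Rational using (_+_; _*_)
  open import Data.Rational.Properties
  open import Relation.Nullary using (yes; no)

  open FiniteSums
  open PowerSeries
  open TreeFunction

  VanishesFrom : ℕ → PS → Set
  VanishesFrom N a = ∀ d → N ℕ.≤ d → a d ≡ 0ℚ

  vanishesFrom-*S : ∀ {P Q a b} → VanishesFrom (suc P) a → VanishesFrom (suc Q) b →
                    VanishesFrom (suc (P ℕ.+ Q)) (a *S b)
  vanishesFrom-*S {P} {Q} {a} {b} a-vanishes b-vanishes D P+Q<D = Σ<-zero (suc D) term-vanishes
    where
    term-vanishes : ∀ i → i ℕ.< suc D → a i * b (D ∸ i) ≡ 0ℚ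
    term-vanishes i _ with i ℕ.≤? P
    ... | no  i≰P = trans (cong (_* b (D ∸ i)) (a-vanishes i (ℕ.≰⇒> i≰P))) (*-zeroˡ (b (D ∸ i)))
    ... | yes i≤P = trans (cong (a i *_) (b-vanishes (D ∸ i) (ℕ.m+n≤o⇒m≤o∸n (suc Q) Q+i<D)))
                          (*-zeroʳ (a i))
      where
      Q+i<D : suc Q ℕ.+ i ℕ.≤ D
      Q+i<D = ℕ.≤-trans (s≤s (ℕ.≤-trans (ℕ.+-monoʳ-≤ Q i≤P) (ℕ.≤-reflexive (ℕ.+-comm Q P)))) P+Q<D

  Σ<-convolution : ∀ M N {a b} (x : ℕ → ℚ) → VanishesFrom M a → VanishesFrom N b →
    Σ< M (λ d → Σ< N (λ e → (a d * b e) * x (d ℕ.+ e))) ≡ Σ< (M ℕ.+ N) (λ D → (a *S b) D * x D)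
  Σ<-convolution M N {a} {b} x a-vanishes b-vanishes = begin
    Σ< M (λ d → Σ< N (λ e → (a d * b e) * x (d ℕ.+ e)))
      ≡⟨ Σ<-extend M (M ℕ.+ N) _ (ℕ.m≤m+n M N) (λ d M≤d _ → Σ<-zero N (λ e _ → a-zero d e M≤d)) ⟩
    Σ< (M ℕ.+ N) (λ d → Σ< N (λ e → (a d * b e) * x (d ℕ.+ e)))
      ≡⟨ Σ<-cong (M ℕ.+ N) (λ d _ → row d) ⟩
    Σ< (M ℕ.+ N) (λ d → Σ< (M ℕ.+ N ∸ d) (λ m → (a d * b ((d ℕ.+ m) ∸ d)) * x (d ℕ.+ m)))
      ≡⟨ Σ<-triangle (M ℕ.+ N) (λ i D → (a i * b (D ∸ i)) * x D) ⟨
    Σ< (M ℕ.+ N) (λ D → Σ< (suc D) (λ i → (a i * b (D ∸ i)) * x D))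
      ≡⟨ Σ<-cong (M ℕ.+ N) (λ D _ → Σ<-*ʳ (suc D) (x D) (λ i → a i * b (D ∸ i))) ⟨
    Σ< (M ℕ.+ N) (λ D → (a *S b) D * x D)
    ∎
    where
    open ≡-Reasoning
    a-zero : ∀ d e → M ℕ.≤ d → (a d * b e) * x (d ℕ.+ e) ≡ 0ℚ
    a-zero d e M≤d rewrite a-vanishes d M≤d | *-zeroˡ (b e) = *-zeroˡ (x (d ℕ.+ e))
    row : ∀ d → Σ< N (λ e → (a d * b e) * x (d ℕ.+ e))
              ≡ Σ< (M ℕ.+ N ∸ d) (λ m → (a d * b ((d ℕ.+ m) ∸ d)) * x (d ℕ.+ m))
    row d with d ℕ.<? M
    ... | no  d≮M = trans (Σ<-zero N (λ e _ → a-zero d e (ℕ.≮⇒≥ d≮M)))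
                          (sym (Σ<-zero (M ℕ.+ N ∸ d) (λ m _ → trans
                            (cong (λ k → (a d * b k) * x (d ℕ.+ m)) (ℕ.m+n∸m≡n d m))
                            (a-zero d m (ℕ.≮⇒≥ d≮M)))))
    ... | yes d<M = trans
      (Σ<-extend N (M ℕ.+ N ∸ d) _ N≤M+N∸d (λ e N≤e _ →
        trans (cong (λ z → (a d * z) * x (d ℕ.+ e)) (b-vanishes e N≤e))
              (trans (cong (_* x (d ℕ.+ e)) (*-zeroʳ (a d))) (*-zeroˡ (x (d ℕ.+ e))))))
      (Σ<-cong (M ℕ.+ N ∸ d) (λ m _ →
        cong (λ k → (a d * b k) * x (d ℕ.+ m)) (sym (ℕ.m+n∸m≡n d m))))
      where
      N≤M+N∸d : N ℕ.≤ M ℕ.+ N ∸ d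
      N≤M+N∸d = ℕ.m+n≤o⇒m≤o∸n N (ℕ.≤-trans (ℕ.+-monoʳ-≤ N (ℕ.<⇒≤ d<M))
                                            (ℕ.≤-reflexive (ℕ.+-comm N M)))

  expansion : ℤ → ℕ → PS → PS
  expansion t N a = ΣS N (λ d → a d ·S negPow (t ℤ.- + d))

  expansion-extend : ∀ t {M N a} → VanishesFrom M a → M ℕ.≤ N →
                     expansion t M a ≈S expansion t N a
  expansion-extend t {M} {N} {a} a-vanishes M≤N n = Σ<-extend M N _ M≤N
    (λ d M≤d _ → trans (cong (_* negPow (t ℤ.- + d) n) (a-vanishes d M≤d))
                       (*-zeroˡ (negPow (t ℤ.- + d) n)))

  expansion-*S : ∀ s t {M N a b} → VanishesFrom M a → VanishesFrom N b →
    (expansion s M a *S expansion t N b) ≈S expansion (s ℤ.+ t) (M ℕ.+ N) (a *S b)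
  expansion-*S s t {M} {N} {a} {b} a-vanishes b-vanishes n = begin
    (expansion s M a *S expansion t N b) n
      ≡⟨ *S-distribʳ-ΣS M (expansion t N b) (λ d → a d ·S X s d) n ⟩
    Σ< M (λ d → ((a d ·S X s d) *S expansion t N b) n)
      ≡⟨ Σ<-cong M (λ d _ → *S-distribˡ-ΣS N (a d ·S X s d) (λ e → b e ·S X t e) n) ⟩
    Σ< M (λ d → Σ< N (λ e → ((a d ·S X s d) *S (b e ·S X t e)) n))
      ≡⟨ Σ<-cong M (λ d _ → Σ<-cong N (λ e _ → term d e)) ⟩
    Σ< M (λ d → Σ< N (λ e → (a d * b e) * X (s ℤ.+ t) (d ℕ.+ e) n))
      ≡⟨ Σ<-convolution M N (λ D → X (s ℤ.+ t) D n) a-vanishes b-vanishes ⟩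
    expansion (s ℤ.+ t) (M ℕ.+ N) (a *S b) n
    ∎
    where
    open ≡-Reasoning
    X : ℤ → ℕ → PS
    X t d = negPow (t ℤ.- + d)
    exponent : ∀ d e → (s ℤ.- + d) ℤ.+ (t ℤ.- + e) ≡ (s ℤ.+ t) ℤ.- + (d ℕ.+ e)
    exponent d e rewrite ℤ.pos-+ d e = rearrange s t (+ d) (+ e)
      where
      rearrange : ∀ s t d e → (s ℤ.- d) ℤ.+ (t ℤ.- e) ≡ (s ℤ.+ t) ℤ.- (d ℤ.+ e)
      rearrange = ℤ-Solver.solve-∀
    term : ∀ d e → ((a d ·S X s d) *S (b e ·S X t e)) n ≡ (a d * b e) * X (s ℤ.+ t) (d ℕ.+ e) n
    term d e = trans (·S-*S-·S (a d) (b e) (X s d) (X t e) n)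
      (cong ((a d * b e) *_) (trans (negPow-+ (s ℤ.- + d) (t ℤ.- + e) n)
                                    (cong (λ i → negPow i n) (exponent d e))))

  truncate : ℕ → PS → PS
  truncate N a d with d ℕ.<? N
  ... | yes _ = a d
  ... | no  _ = 0ℚ

  truncate-< : ∀ {N} a {d} → d ℕ.< N → truncate N a d ≡ a d
  truncate-< {N} a {d} d<N with d ℕ.<? N
  ... | yes _   = refl
  ... | no  d≮N = ⊥-elim (d≮N d<N)

  truncate-vanishes : ∀ N a → VanishesFrom N (truncate N a)
  truncate-vanishes N a d N≤d with d ℕ.<? N
  ... | yes d<N = ⊥-elim (ℕ.<⇒≱ d<N N≤d)
  ... | no  _   = refl

  expansion-truncate : ∀ t N a → expansion t N (truncate N a) ≈S expansion t N a
  expansion-truncate t N a n = Σ<-cong N (λ d d<N → cong (_* negPow (t ℤ.- + d) n) (truncate-< a d<N))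

module WeightedSums (L : ℕ) where

  open import Data.Rational using (_+_; _*_; _-_; _≤_)
  open import Data.Rational.Properties

  open Rationals
  open FiniteSums

  weighted : ℕ → (ℕ → ℚ) → ℚ
  weighted r h = ½ * Σ1to (r ⊓ L) (λ k → nat k * h k)

  weighted-cong : ∀ r {h h′ : ℕ → ℚ} → (∀ j → j ℕ.< r → h (suc j) ≡ h′ (suc j)) →
                  weighted r h ≡ weighted r h′
  weighted-cong r eq = cong (½ *_) (Σ<-cong (r ⊓ L) (λ j j<r⊓L →
    cong (nat (suc j) *_) (eq j (ℕ.m<n⊓o⇒m<n r L j<r⊓L))))

  weighted-mono-≤ : ∀ r {h h′ : ℕ → ℚ} → (∀ j → j ℕ.< r → h (suc j) ≤ h′ (suc j)) →
                    weighted r h ≤ weighted r h′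
  weighted-mono-≤ r le = *-monoˡ-≤-0≤ (<⇒≤ (positive⁻¹ ½)) (Σ<-mono-≤ (r ⊓ L) (λ j j<r⊓L →
    *-monoˡ-≤-0≤ (<⇒≤ (nat-suc-pos j)) (le j (ℕ.m<n⊓o⇒m<n r L j<r⊓L))))

  weighted-zero : ∀ r (h : ℕ → ℚ) → (∀ j → j ℕ.< r → h (suc j) ≡ 0ℚ) → weighted r h ≡ 0ℚ
  weighted-zero r h eq = trans (cong (½ *_) (Σ<-zero (r ⊓ L) (λ j j<r⊓L →
    trans (cong (nat (suc j) *_) (eq j (ℕ.m<n⊓o⇒m<n r L j<r⊓L))) (*-zeroʳ (nat (suc j))))))
    (*-zeroʳ ½)

  weighted-nonNeg : ∀ r (h : ℕ → ℚ) → (∀ j → j ℕ.< r → 0ℚ ≤ h (suc j)) → 0ℚ ≤ weighted r h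
  weighted-nonNeg r h nonNeg =
    subst (_≤ weighted r h) (weighted-zero r (λ _ → 0ℚ) (λ _ _ → refl))
      (weighted-mono-≤ r {λ _ → 0ℚ} {h} nonNeg)

  weighted-pos : ∀ r (h : ℕ → ℚ) → 1 ℕ.≤ L → (∀ j → j ℕ.< suc r → 0ℚ < h (suc j)) →
                 0ℚ < weighted (suc r) h
  weighted-pos r h (s≤s {n = L′} _) pos =
    *-pos (positive⁻¹ ½) (Σ<-pos (r ⊓ L′) {λ j → nat (suc j) * h (suc j)} (λ j j≤r⊓L′ →
      *-pos (nat-suc-pos j) (pos j (ℕ.m<n⊓o⇒m<n (suc r) (suc L′) j≤r⊓L′))))

  weighted-*ʳ : ∀ r (h : ℕ → ℚ) x → weighted r (λ k → h k * x) ≡ weighted r h * x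
  weighted-*ʳ r h x = begin
    ½ * Σ< (r ⊓ L) (λ j → nat (suc j) * (h (suc j) * x))
      ≡⟨ cong (½ *_) (Σ<-cong (r ⊓ L) (λ j _ → *-assoc (nat (suc j)) (h (suc j)) x)) ⟨
    ½ * Σ< (r ⊓ L) (λ j → (nat (suc j) * h (suc j)) * x)
      ≡⟨ cong (½ *_) (Σ<-*ʳ (r ⊓ L) x (λ j → nat (suc j) * h (suc j))) ⟨
    ½ * (Σ< (r ⊓ L) (λ j → nat (suc j) * h (suc j)) * x)
      ≡⟨ *-assoc ½ (Σ1to (r ⊓ L) (λ k → nat k * h k)) x ⟨
    weighted r h * x
    ∎
    where open ≡-Reasoning

  weighted-+ : ∀ r (h h′ : ℕ → ℚ) → weighted r (λ k → h k + h′ k) ≡ weighted r h + weighted r h′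
  weighted-+ r h h′ = begin
    ½ * Σ< (r ⊓ L) (λ j → nat (suc j) * (h (suc j) + h′ (suc j)))
      ≡⟨ cong (½ *_) (Σ<-cong (r ⊓ L) (λ j _ → *-distribˡ-+ (nat (suc j)) (h (suc j)) (h′ (suc j)))) ⟩
    ½ * Σ< (r ⊓ L) (λ j → nat (suc j) * h (suc j) + nat (suc j) * h′ (suc j))
      ≡⟨ cong (½ *_) (Σ<-distrib-+ (r ⊓ L) (λ j → nat (suc j) * h (suc j))
                                          (λ j → nat (suc j) * h′ (suc j))) ⟩
    ½ * (Σ1to (r ⊓ L) (λ k → nat k * h k) + Σ1to (r ⊓ L) (λ k → nat k * h′ k))
      ≡⟨ *-distribˡ-+ ½ (Σ1to (r ⊓ L) (λ k → nat k * h k)) (Σ1to (r ⊓ L) (λ k → nat k * h′ k)) ⟩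
    weighted r h + weighted r h′
    ∎
    where open ≡-Reasoning

  weighted-neg : ∀ r (h : ℕ → ℚ) → weighted r (λ k → - h k) ≡ - weighted r h
  weighted-neg r h = begin
    ½ * Σ< (r ⊓ L) (λ j → nat (suc j) * - h (suc j))
      ≡⟨ cong (½ *_) (Σ<-cong (r ⊓ L) (λ j _ → neg-distribʳ-* (nat (suc j)) (h (suc j)))) ⟨
    ½ * Σ< (r ⊓ L) (λ j → - (nat (suc j) * h (suc j)))
      ≡⟨ cong (½ *_) (Σ<-neg (r ⊓ L) (λ j → nat (suc j) * h (suc j))) ⟨
    ½ * - Σ1to (r ⊓ L) (λ k → nat k * h k)
      ≡⟨ neg-distribʳ-* ½ (Σ1to (r ⊓ L) (λ k → nat k * h k)) ⟨
    - weighted r h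
    ∎
    where open ≡-Reasoning

  weighted-Σ< : ∀ r N (h : ℕ → ℕ → ℚ) →
                Σ< N (λ d → weighted r (λ k → h k d)) ≡ weighted r (λ k → Σ< N (h k))
  weighted-Σ< r N h = begin
    Σ< N (λ d → ½ * Σ< (r ⊓ L) (λ j → nat (suc j) * h (suc j) d))
      ≡⟨ Σ<-*ˡ N ½ (λ d → Σ< (r ⊓ L) (λ j → nat (suc j) * h (suc j) d)) ⟨
    ½ * Σ< N (λ d → Σ< (r ⊓ L) (λ j → nat (suc j) * h (suc j) d))
      ≡⟨ cong (½ *_) (Σ<-swap N (r ⊓ L) (λ d j → nat (suc j) * h (suc j) d)) ⟩
    ½ * Σ< (r ⊓ L) (λ j → Σ< N (λ d → nat (suc j) * h (suc j) d))
      ≡⟨ cong (½ *_) (Σ<-cong (r ⊓ L) (λ j _ → Σ<-*ˡ N (nat (suc j)) (h (suc j)))) ⟨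
    weighted r (λ k → Σ< N (h k))
    ∎
    where open ≡-Reasoning

  weighted-affine : ∀ r (h h′ : ℕ → ℚ) x y →
    weighted r (λ k → h k * x - h′ k * y) ≡ weighted r h * x - weighted r h′ * y
  weighted-affine r h h′ x y = begin
    weighted r (λ k → h k * x - h′ k * y)
      ≡⟨ weighted-+ r (λ k → h k * x) (λ k → - (h′ k * y)) ⟩
    weighted r (λ k → h k * x) + weighted r (λ k → - (h′ k * y))
      ≡⟨ cong₂ _+_ (weighted-*ʳ r h x) (trans (weighted-neg r (λ k → h′ k * y))
                                              (cong -_ (weighted-*ʳ r h′ y))) ⟩
    weighted r h * x - weighted r h′ * y
    ∎
    where open ≡-Reasoning

module WrightRecurrence
  (Cnt : ℕ → ℕ → ℕ)
  (c : ℕ → ℕ → ℚ)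
  (C-expansion : ∀ ℓ → 1 ℕ.≤ ℓ →
    Cser Cnt ℓ ≈S ΣS (3 ℕ.* ℓ ℕ.+ 3) (λ d → c ℓ d ·S negPow (+ (3 ℕ.* ℓ) ℤ.- + d)))
  (c-pos : ∀ ℓ → 1 ℕ.≤ ℓ → 0ℚ < c ℓ 0)
  (d-pos : ∀ ℓ → 1 ℕ.≤ ℓ → 0ℚ < - c ℓ 1)
  (C-lower : ∀ ℓ → 1 ℕ.≤ ℓ →
    ((c ℓ 0 ·S negPow (+ (3 ℕ.* ℓ))) -S ((- c ℓ 1) ·S negPow (+ (3 ℕ.* ℓ) ℤ.- + 1)))
      ≤c Cser Cnt ℓ)
  (C-upper : ∀ ℓ → 1 ℕ.≤ ℓ → Cser Cnt ℓ ≤c (c ℓ 0 ·S negPow (+ (3 ℕ.* ℓ))))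
  (L : ℕ) (1≤L : 1 ℕ.≤ L)
  (F : ℕ → PS)
  (F-zero : F 0 ≈S oneS)
  (F-rec : ∀ r → 1 ℕ.≤ r →
    (nat r ·S F r) ≈S (½ ·S ΣS1to (r ⊓ L) (λ k → nat k ·S (Cser Cnt k *S F (r ∸ k)))))
  where

  open import Data.Nat.Induction using (<-rec)
  open import Data.Nat.Tactic.RingSolver as ℕ-Solver using ()
  open import Data.Integer.Tactic.RingSolver as ℤ-Solver using ()
  open import Data.Rational using (_+_; _*_; _-_; _≤_)
  open import Data.Rational.Properties
  open import Tactic.RingSolver using (solve-∀)

  open Rationals
  open FiniteSums
  open PowerSeries
  open TreeFunction
  open Expansions

  open WeightedSums L

  C : ℕ → PS
  C = Cser Cnt

  X Y : ℕ → PS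
  X r = negPow (+ (3 ℕ.* r))
  Y r = negPow (+ (3 ℕ.* r) ℤ.- + 1)

  exponent-+ : ∀ k s {R} → k ℕ.+ s ≡ R → + (3 ℕ.* k) ℤ.+ + (3 ℕ.* s) ≡ + (3 ℕ.* R)
  exponent-+ k s refl = cong +_ (sym (ℕ.*-distribˡ-+ 3 k s))

  X*X : ∀ k s {R} → k ℕ.+ s ≡ R → (X k *S X s) ≈S X R
  X*X k s k+s≡R = negPow-+-≡ (+ (3 ℕ.* k)) (+ (3 ℕ.* s)) (exponent-+ k s k+s≡R)

  Y*X : ∀ k s {R} → k ℕ.+ s ≡ R → (Y k *S X s) ≈S Y R
  Y*X k s k+s≡R = negPow-+-≡ (+ (3 ℕ.* k) ℤ.- + 1) (+ (3 ℕ.* s))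
    (trans (shift (+ (3 ℕ.* k)) (+ (3 ℕ.* s))) (cong (ℤ._- + 1) (exponent-+ k s k+s≡R)))
    where
    shift : ∀ a b → (a ℤ.- + 1) ℤ.+ b ≡ (a ℤ.+ b) ℤ.- + 1
    shift = ℤ-Solver.solve-∀

  X*Y : ∀ k s {R} → k ℕ.+ s ≡ R → (X k *S Y s) ≈S Y R
  X*Y k s k+s≡R = negPow-+-≡ (+ (3 ℕ.* k)) (+ (3 ℕ.* s) ℤ.- + 1)
    (trans (shift (+ (3 ℕ.* k)) (+ (3 ℕ.* s))) (cong (ℤ._- + 1) (exponent-+ k s k+s≡R)))
    where
    shift : ∀ a b → a ℤ.+ (b ℤ.- + 1) ≡ (a ℤ.+ b) ℤ.- + 1
    shift = ℤ-Solver.solve-∀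

  split : ∀ {r j} → j ℕ.≤ r → suc j ℕ.+ (r ∸ j) ≡ suc r
  split j≤r = cong suc (ℕ.m+[n∸m]≡n j≤r)

  F-unfold : ∀ r n → F (suc r) n ≡ 1/suc r * weighted (suc r) (λ k → (C k *S F (suc r ∸ k)) n)
  F-unfold r n = trans (sym (1/suc-cancel r (F (suc r) n))) (cong (1/suc r *_) (F-rec (suc r) (s≤s z≤n) n))

  F-nonNeg : ∀ r → NonNegS (F r)
  F-nonNeg = <-rec (λ r → NonNegS (F r)) go
    where
    go : ∀ r → (∀ {s} → s ℕ.< r → NonNegS (F s)) → NonNegS (F r)
    go zero    _  n = subst (0ℚ ≤_) (sym (F-zero n)) (oneS-nonNeg n)
    go (suc r) ih n = subst (0ℚ ≤_) (sym (F-unfold r n))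
      (*-nonNeg (<⇒≤ (1/suc-pos r)) (weighted-nonNeg (suc r) (λ k → (C k *S F (suc r ∸ k)) n) (λ j _ →
        *S-nonNeg (Cser-nonNeg Cnt (suc j)) (ih (s≤s (ℕ.m∸n≤m r j))) n)))

  -- c ℓ d is unconstrained for d ≥ 3ℓ + 3; truncating it there keeps the coefficients of F_r
  -- finitely supported.
  c′ : ℕ → PS
  c′ k = truncate (3 ℕ.* k ℕ.+ 3) (c k)

  c′-vanishes : ∀ k → VanishesFrom (suc (3 ℕ.* k ℕ.+ 2)) (c′ k)
  c′-vanishes k = subst (λ N → VanishesFrom N (c′ k)) (ℕ.+-suc (3 ℕ.* k) 2)
                        (truncate-vanishes (3 ℕ.* k ℕ.+ 3) (c k))

  c′-low : ∀ k {d} → d ℕ.< 3 → c′ k d ≡ c k d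
  c′-low k d<3 = truncate-< (c k) (ℕ.≤-trans d<3 (ℕ.m≤n+m 3 (3 ℕ.* k)))

  c′*S-0 : ∀ k a → (c′ k *S a) 0 ≡ c k 0 * a 0
  c′*S-0 k a = trans (+-identityˡ (c′ k 0 * a 0)) (cong (_* a 0) (c′-low k (s≤s z≤n)))

  c′*S-1 : ∀ k a → (c′ k *S a) 1 ≡ c k 0 * a 1 + c k 1 * a 0
  c′*S-1 k a = cong₂ _+_ (c′*S-0 k (λ d → a (suc d))) (cong (_* a 0) (c′-low k (s≤s (s≤s z≤n))))

  -- Course-of-values recursion through fuel: coeffFuel n r is correct as soon as r ≤ n.
  coeffFuel : ℕ → ℕ → PS
  coeffFuel zero    _       = oneS
  coeffFuel (suc n) zero    = oneS
  coeffFuel (suc n) (suc r) d =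
    1/suc r * weighted (suc r) (λ k → (c′ k *S coeffFuel n (suc r ∸ k)) d)

  coeff : ℕ → PS
  coeff r = coeffFuel r r

  coeffFuel-zero : ∀ n → coeffFuel n 0 ≈S oneS
  coeffFuel-zero zero    = ≈S-refl
  coeffFuel-zero (suc n) = ≈S-refl

  coeffFuel-stable : ∀ n m r → r ℕ.≤ n → r ℕ.≤ m → coeffFuel n r ≈S coeffFuel m r
  coeffFuel-stable n m zero _ _ = ≈S-trans (coeffFuel-zero n) (≈S-sym (coeffFuel-zero m))
  coeffFuel-stable (suc n) (suc m) (suc r) (s≤s r≤n) (s≤s r≤m) d =
    cong (1/suc r *_) (weighted-cong (suc r)
      {λ k → (c′ k *S coeffFuel n (suc r ∸ k)) d} {λ k → (c′ k *S coeffFuel m (suc r ∸ k)) d} (λ j _ →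
      *S-cong {c′ (suc j)} ≈S-refl (coeffFuel-stable n m (r ∸ j)
        (ℕ.≤-trans (ℕ.m∸n≤m r j) r≤n) (ℕ.≤-trans (ℕ.m∸n≤m r j) r≤m)) d))

  coeff-suc : ∀ r d →
    coeff (suc r) d ≡ 1/suc r * weighted (suc r) (λ k → (c′ k *S coeff (suc r ∸ k)) d)
  coeff-suc r d = cong (1/suc r *_) (weighted-cong (suc r)
    {λ k → (c′ k *S coeffFuel r (suc r ∸ k)) d} {λ k → (c′ k *S coeff (suc r ∸ k)) d} (λ j _ →
    *S-cong {c′ (suc j)} ≈S-refl (coeffFuel-stable r (r ∸ j) (r ∸ j) (ℕ.m∸n≤m r j) ℕ.≤-refl) d))

  f g : ℕ → ℚ
  f r = coeff r 0
  g r = - coeff r 1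

  f-suc : ∀ r → f (suc r) ≡ 1/suc r * weighted (suc r) (λ k → c k 0 * f (suc r ∸ k))
  f-suc r = trans (coeff-suc r 0) (cong (1/suc r *_) (weighted-cong (suc r)
    {λ k → (c′ k *S coeff (suc r ∸ k)) 0} {λ k → c k 0 * f (suc r ∸ k)} (λ j _ →
    c′*S-0 (suc j) (coeff (r ∸ j)))))

  g-suc : ∀ r → g (suc r) ≡
    1/suc r * weighted (suc r) (λ k → c k 0 * g (suc r ∸ k) + (- c k 1) * f (suc r ∸ k))
  g-suc r = begin
    - coeff (suc r) 1
      ≡⟨ cong -_ (coeff-suc r 1) ⟩
    - (1/suc r * weighted (suc r) P₁)
      ≡⟨ neg-distribʳ-* (1/suc r) (weighted (suc r) P₁) ⟩
    1/suc r * - weighted (suc r) P₁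
      ≡⟨ cong (1/suc r *_) (weighted-neg (suc r) P₁) ⟨
    1/suc r * weighted (suc r) (λ k → - P₁ k)
      ≡⟨ cong (1/suc r *_) (weighted-cong (suc r)
           {λ k → - P₁ k} {λ k → c k 0 * g (suc r ∸ k) + (- c k 1) * f (suc r ∸ k)} (λ j _ →
           trans (cong -_ (c′*S-1 (suc j) (coeff (r ∸ j))))
                 (negate (c (suc j) 0) (coeff (r ∸ j) 1) (c (suc j) 1) (coeff (r ∸ j) 0)))) ⟩
    1/suc r * weighted (suc r) (λ k → c k 0 * g (suc r ∸ k) + (- c k 1) * f (suc r ∸ k))
    ∎
    where
    open ≡-Reasoning
    P₁ : ℕ → ℚ
    P₁ k = (c′ k *S coeff (suc r ∸ k)) 1
    negate : ∀ a x b y → - (a * x + b * y) ≡ a * (- x) + (- b) * y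
    negate = solve-∀ ℚ-ring

  f-rec : ∀ r → nat (suc r) * f (suc r) ≡ weighted (suc r) (λ k → c k 0 * f (suc r ∸ k))
  f-rec r = trans (cong (nat (suc r) *_) (f-suc r)) (nat-suc-cancel r _)

  g-rec : ∀ r → nat (suc r) * g (suc r) ≡
    weighted (suc r) (λ k → c k 0 * g (suc r ∸ k)) + weighted (suc r) (λ k → (- c k 1) * f (suc r ∸ k))
  g-rec r = trans (cong (nat (suc r) *_) (g-suc r)) (trans (nat-suc-cancel r _)
    (weighted-+ (suc r) (λ k → c k 0 * g (suc r ∸ k)) (λ k → (- c k 1) * f (suc r ∸ k))))

  f-pos : ∀ r → 0ℚ < f r
  f-pos = <-rec (λ r → 0ℚ < f r) go
    where
    go : ∀ r → (∀ {s} → s ℕ.< r → 0ℚ < f s) → 0ℚ < f r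
    go zero    _  = positive⁻¹ 1ℚ
    go (suc r) ih = subst (0ℚ <_) (sym (f-suc r))
      (*-pos (1/suc-pos r) (weighted-pos r (λ k → c k 0 * f (suc r ∸ k)) 1≤L summand-pos))
      where
      summand-pos : ∀ j → j ℕ.< suc r → 0ℚ < c (suc j) 0 * f (r ∸ j)
      summand-pos j _ = *-pos (c-pos (suc j) (s≤s z≤n)) (ih (s≤s (ℕ.m∸n≤m r j)))

  g-pos : ∀ r → 0ℚ < g (suc r)
  g-pos = <-rec (λ r → 0ℚ < g (suc r)) go
    where
    go : ∀ r → (∀ {s} → s ℕ.< r → 0ℚ < g (suc s)) → 0ℚ < g (suc r)
    go r ih = subst (0ℚ <_) (sym (g-suc r))
      (*-pos (1/suc-pos r) (weighted-pos r B 1≤L summand-pos))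
      where
      B : ℕ → ℚ
      B k = c k 0 * g (suc r ∸ k) + (- c k 1) * f (suc r ∸ k)
      g-nonNeg′ : ∀ s → s ℕ.≤ r → 0ℚ ≤ g s
      g-nonNeg′ zero    _   = ≤-refl
      g-nonNeg′ (suc s) s<r = <⇒≤ (ih s<r)
      summand-pos : ∀ j → j ℕ.< suc r → 0ℚ < B (suc j)
      summand-pos j _ =
        +-mono-≤-< (*-nonNeg (<⇒≤ (c-pos (suc j) (s≤s z≤n))) (g-nonNeg′ (r ∸ j) (ℕ.m∸n≤m r j)))
                   (*-pos (d-pos (suc j) (s≤s z≤n)) (f-pos (r ∸ j)))

  g-nonNeg : ∀ s → 0ℚ ≤ g s
  g-nonNeg zero    = ≤-refl
  g-nonNeg (suc s) = <⇒≤ (g-pos s)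

  degree-bound : ∀ j s {R} → suc j ℕ.+ s ≡ R →
                 suc (3 ℕ.* suc j ℕ.+ 2 ℕ.+ 5 ℕ.* s) ℕ.≤ suc (5 ℕ.* R)
  degree-bound j s refl =
    s≤s (subst (3 ℕ.* suc j ℕ.+ 2 ℕ.+ 5 ℕ.* s ℕ.≤_) (slack j s) (ℕ.m≤m+n _ (2 ℕ.* j)))
    where
    slack : ∀ j s → 3 ℕ.* suc j ℕ.+ 2 ℕ.+ 5 ℕ.* s ℕ.+ 2 ℕ.* j ≡ 5 ℕ.* (suc j ℕ.+ s)
    slack = ℕ-Solver.solve-∀

  coeff-vanishes : ∀ r → VanishesFrom (suc (5 ℕ.* r)) (coeff r)
  coeff-vanishes = <-rec (λ r → VanishesFrom (suc (5 ℕ.* r)) (coeff r)) go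
    where
    go : ∀ r → (∀ {s} → s ℕ.< r → VanishesFrom (suc (5 ℕ.* s)) (coeff s)) →
         VanishesFrom (suc (5 ℕ.* r)) (coeff r)
    go zero    _  (suc d) _     = refl
    go (suc r) ih d       5r<d = begin
      coeff (suc r) d
        ≡⟨ coeff-suc r d ⟩
      1/suc r * weighted (suc r) (λ k → (c′ k *S coeff (suc r ∸ k)) d)
        ≡⟨ cong (1/suc r *_) (weighted-zero (suc r) (λ k → (c′ k *S coeff (suc r ∸ k)) d) (λ j j<1+r →
             vanishesFrom-*S (c′-vanishes (suc j)) (ih (s≤s (ℕ.m∸n≤m r j))) d
               (ℕ.≤-trans (degree-bound j (r ∸ j) (split (ℕ.≤-pred j<1+r))) 5r<d))) ⟩
      1/suc r * 0ℚ
        ≡⟨ *-zeroʳ (1/suc r) ⟩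
      0ℚ
      ∎
      where open ≡-Reasoning

  C-expansion-truncated : ∀ k → 1 ℕ.≤ k → C k ≈S expansion (+ (3 ℕ.* k)) (3 ℕ.* k ℕ.+ 3) (c′ k)
  C-expansion-truncated k 1≤k = ≈S-trans (C-expansion k 1≤k)
    (≈S-sym (expansion-truncate (+ (3 ℕ.* k)) (3 ℕ.* k ℕ.+ 3) (c k)))

  product-expansion : ∀ j s {R} → suc j ℕ.+ s ≡ R →
    F s ≈S expansion (+ (3 ℕ.* s)) (suc (5 ℕ.* s)) (coeff s) →
    (C (suc j) *S F s) ≈S expansion (+ (3 ℕ.* R)) (suc (5 ℕ.* R)) (c′ (suc j) *S coeff s)
  product-expansion j s {R} k+s≡R F-exp n = begin
    (C k *S F s) n
      ≡⟨ *S-cong (C-expansion-truncated k (s≤s z≤n)) F-exp n ⟩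
    (expansion (+ (3 ℕ.* k)) (3 ℕ.* k ℕ.+ 3) (c′ k) *S expansion (+ (3 ℕ.* s)) (suc (5 ℕ.* s)) (coeff s)) n
      ≡⟨ expansion-*S (+ (3 ℕ.* k)) (+ (3 ℕ.* s))
           (truncate-vanishes (3 ℕ.* k ℕ.+ 3) (c k)) (coeff-vanishes s) n ⟩
    expansion t (3 ℕ.* k ℕ.+ 3 ℕ.+ suc (5 ℕ.* s)) P n
      ≡⟨ expansion-extend t P-vanishes product-bound n ⟨
    expansion t (suc (3 ℕ.* k ℕ.+ 2 ℕ.+ 5 ℕ.* s)) P n
      ≡⟨ expansion-extend t P-vanishes (degree-bound j s k+s≡R) n ⟩
    expansion t (suc (5 ℕ.* R)) P n
      ≡⟨ cong (λ t → expansion t (suc (5 ℕ.* R)) P n) (exponent-+ k s k+s≡R) ⟩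
    expansion (+ (3 ℕ.* R)) (suc (5 ℕ.* R)) P n
    ∎
    where
    open ≡-Reasoning
    k = suc j
    t = + (3 ℕ.* k) ℤ.+ + (3 ℕ.* s)
    P = c′ k *S coeff s
    P-vanishes : VanishesFrom (suc (3 ℕ.* k ℕ.+ 2 ℕ.+ 5 ℕ.* s)) P
    P-vanishes = vanishesFrom-*S (c′-vanishes k) (coeff-vanishes s)
    product-bound : suc (3 ℕ.* k ℕ.+ 2 ℕ.+ 5 ℕ.* s) ℕ.≤ 3 ℕ.* k ℕ.+ 3 ℕ.+ suc (5 ℕ.* s)
    product-bound = subst (suc (3 ℕ.* k ℕ.+ 2 ℕ.+ 5 ℕ.* s) ℕ.≤_) (slack k s) (ℕ.m≤m+n _ 1)
      where
      slack : ∀ k s → suc (3 ℕ.* k ℕ.+ 2 ℕ.+ 5 ℕ.* s) ℕ.+ 1 ≡ 3 ℕ.* k ℕ.+ 3 ℕ.+ suc (5 ℕ.* s)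
      slack = ℕ-Solver.solve-∀

  F-expansion : ∀ r → F r ≈S expansion (+ (3 ℕ.* r)) (suc (5 ℕ.* r)) (coeff r)
  F-expansion = <-rec (λ r → F r ≈S expansion (+ (3 ℕ.* r)) (suc (5 ℕ.* r)) (coeff r)) go
    where
    go : ∀ r → (∀ {s} → s ℕ.< r → F s ≈S expansion (+ (3 ℕ.* s)) (suc (5 ℕ.* s)) (coeff s)) →
         F r ≈S expansion (+ (3 ℕ.* r)) (suc (5 ℕ.* r)) (coeff r)
    go zero    _  n = trans (F-zero n) (sym (trans (+-identityˡ (1ℚ * oneS n)) (*-identityˡ (oneS n))))
    go (suc r) ih n = begin
      F (suc r) n
        ≡⟨ F-unfold r n ⟩
      1/suc r * weighted (suc r) (λ k → (C k *S F (suc r ∸ k)) n)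
        ≡⟨ cong (1/suc r *_) (weighted-cong (suc r)
             {λ k → (C k *S F (suc r ∸ k)) n} {λ k → Σ< N (λ d → P k d * x d)} (λ j j<1+r →
             product-expansion j (r ∸ j) (split (ℕ.≤-pred j<1+r)) (ih (s≤s (ℕ.m∸n≤m r j))) n)) ⟩
      1/suc r * weighted (suc r) (λ k → Σ< N (λ d → P k d * x d))
        ≡⟨ cong (1/suc r *_) (weighted-Σ< (suc r) N (λ k d → P k d * x d)) ⟨
      1/suc r * Σ< N (λ d → weighted (suc r) (λ k → P k d * x d))
        ≡⟨ Σ<-*ˡ N (1/suc r) (λ d → weighted (suc r) (λ k → P k d * x d)) ⟩
      Σ< N (λ d → 1/suc r * weighted (suc r) (λ k → P k d * x d))
        ≡⟨ Σ<-cong N (λ d _ → trans (cong (1/suc r *_) (weighted-*ʳ (suc r) (λ k → P k d) (x d)))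
                              (trans (sym (*-assoc (1/suc r) _ (x d)))
                                     (cong (_* x d) (sym (coeff-suc r d))))) ⟩
      Σ< N (λ d → coeff (suc r) d * x d)
      ∎
      where
      open ≡-Reasoning
      N = suc (5 ℕ.* suc r)
      P : ℕ → PS
      P k = c′ k *S coeff (suc r ∸ k)
      x : ℕ → ℚ
      x d = negPow (+ (3 ℕ.* suc r) ℤ.- + d) n

  g·Y-nonNeg : ∀ s → NonNegS (g s ·S Y s)
  g·Y-nonNeg zero    n = ≤-reflexive (sym (*-zeroˡ (Y 0 n)))
  g·Y-nonNeg (suc s) = ·S-nonNeg (g-nonNeg (suc s)) (negPow-nonNeg (s ℕ.+ 2 ℕ.* suc s))

  product-upper : ∀ j s {R} → suc j ℕ.+ s ≡ R → F s ≤c (f s ·S X s) →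
    (C (suc j) *S F s) ≤c ((c (suc j) 0 * f s) ·S X R)
  product-upper j s k+s≡R F≤ n = ≤-trans
    (*S-mono-≤c (·S-nonNeg (<⇒≤ (c-pos k (s≤s z≤n))) (negPow-nonNeg (3 ℕ.* k)))
                (F-nonNeg s) (C-upper k (s≤s z≤n)) F≤ n)
    (≤-reflexive (trans (·S-*S-·S (c k 0) (f s) (X k) (X s) n)
                        (cong (c k 0 * f s *_) (X*X k s k+s≡R n))))
    where k = suc j

  product-lower : ∀ j s {R} → suc j ℕ.+ s ≡ R → ((f s ·S X s) -S (g s ·S Y s)) ≤c F s →
    (((c (suc j) 0 * f s) ·S X R) -S ((c (suc j) 0 * g s + (- c (suc j) 1) * f s) ·S Y R))
      ≤c (C (suc j) *S F s)
  product-lower j s {R} k+s≡R ≤F n = ≤-trans (≤-reflexive (sym expand))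
    (*S-lowerBound (Cser-nonNeg Cnt k) (·S-nonNeg (<⇒≤ (f-pos s)) (negPow-nonNeg (3 ℕ.* s)))
                   (g·Y-nonNeg s) (C-lower k (s≤s z≤n)) (C-upper k (s≤s z≤n)) ≤F n)
    where
    k = suc j
    p = c k 0
    q = - c k 1
    expand : ((((p ·S X k) -S (q ·S Y k)) *S (f s ·S X s)) -S ((p ·S X k) *S (g s ·S Y s))) n
             ≡ (p * f s) * X R n - (p * g s + q * f s) * Y R n
    expand = begin
      (((p ·S X k) -S (q ·S Y k)) *S (f s ·S X s)) n - ((p ·S X k) *S (g s ·S Y s)) n
        ≡⟨ cong (_- ((p ·S X k) *S (g s ·S Y s)) n) (*S-distribʳ-sub (f s ·S X s) (p ·S X k) (q ·S Y k) n) ⟩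
      (((p ·S X k) *S (f s ·S X s)) n - ((q ·S Y k) *S (f s ·S X s)) n) - ((p ·S X k) *S (g s ·S Y s)) n
        ≡⟨ cong₂ _-_ (cong₂ _-_ (·S-*S-·S p (f s) (X k) (X s) n) (·S-*S-·S q (f s) (Y k) (X s) n))
                     (·S-*S-·S p (g s) (X k) (Y s) n) ⟩
      ((p * f s) * (X k *S X s) n - (q * f s) * (Y k *S X s) n) - (p * g s) * (X k *S Y s) n
        ≡⟨ cong₂ _-_ (cong₂ _-_ (cong (p * f s *_) (X*X k s k+s≡R n)) (cong (q * f s *_) (Y*X k s k+s≡R n)))
                     (cong (p * g s *_) (X*Y k s k+s≡R n)) ⟩
      ((p * f s) * X R n - (q * f s) * Y R n) - (p * g s) * Y R n
        ≡⟨ collect (p * f s) (q * f s) (p * g s) (X R n) (Y R n) ⟩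
      (p * f s) * X R n - (p * g s + q * f s) * Y R n
      ∎
      where
      open ≡-Reasoning
      collect : ∀ a b e x y → (a * x - b * y) - e * y ≡ a * x - (e + b) * y
      collect = solve-∀ ℚ-ring

  F-upper : ∀ r → F r ≤c (f r ·S X r)
  F-upper = <-rec (λ r → F r ≤c (f r ·S X r)) go
    where
    go : ∀ r → (∀ {s} → s ℕ.< r → F s ≤c (f s ·S X s)) → F r ≤c (f r ·S X r)
    go zero    _  n = ≤-reflexive (trans (F-zero n) (sym (*-identityˡ (oneS n))))
    go (suc r) ih n = begin
      F (suc r) n
        ≡⟨ F-unfold r n ⟩
      1/suc r * weighted (suc r) (λ k → (C k *S F (suc r ∸ k)) n)
        ≤⟨ *-monoˡ-≤-0≤ (<⇒≤ (1/suc-pos r)) (weighted-mono-≤ (suc r)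
             {λ k → (C k *S F (suc r ∸ k)) n} {λ k → A k * X (suc r) n} (λ j j<1+r →
             product-upper j (r ∸ j) (split (ℕ.≤-pred j<1+r)) (ih (s≤s (ℕ.m∸n≤m r j))) n)) ⟩
      1/suc r * weighted (suc r) (λ k → A k * X (suc r) n)
        ≡⟨ cong (1/suc r *_) (weighted-*ʳ (suc r) A (X (suc r) n)) ⟩
      1/suc r * (weighted (suc r) A * X (suc r) n)
        ≡⟨ *-assoc (1/suc r) (weighted (suc r) A) (X (suc r) n) ⟨
      (1/suc r * weighted (suc r) A) * X (suc r) n
        ≡⟨ cong (_* X (suc r) n) (f-suc r) ⟨
      f (suc r) * X (suc r) n
      ∎
      where
      open ≤-Reasoning
      A : ℕ → ℚ
      A k = c k 0 * f (suc r ∸ k)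

  F-lower : ∀ r → ((f r ·S X r) -S (g r ·S Y r)) ≤c F r
  F-lower = <-rec (λ r → ((f r ·S X r) -S (g r ·S Y r)) ≤c F r) go
    where
    go : ∀ r → (∀ {s} → s ℕ.< r → ((f s ·S X s) -S (g s ·S Y s)) ≤c F s) →
         ((f r ·S X r) -S (g r ·S Y r)) ≤c F r
    go zero    _  n = ≤-reflexive (trans (base (oneS n) (Y 0 n)) (sym (F-zero n)))
      where
      base : ∀ a b → 1ℚ * a - 0ℚ * b ≡ a
      base = solve-∀ ℚ-ring
    go (suc r) ih n = begin
      f (suc r) * x - g (suc r) * y
        ≡⟨ cong₂ (λ a b → a * x - b * y) (f-suc r) (g-suc r) ⟩
      (1/suc r * weighted (suc r) A) * x - (1/suc r * weighted (suc r) B) * y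
        ≡⟨ factor (1/suc r) (weighted (suc r) A) (weighted (suc r) B) x y ⟩
      1/suc r * (weighted (suc r) A * x - weighted (suc r) B * y)
        ≡⟨ cong (1/suc r *_) (weighted-affine (suc r) A B x y) ⟨
      1/suc r * weighted (suc r) (λ k → A k * x - B k * y)
        ≤⟨ *-monoˡ-≤-0≤ (<⇒≤ (1/suc-pos r)) (weighted-mono-≤ (suc r)
             {λ k → A k * x - B k * y} {λ k → (C k *S F (suc r ∸ k)) n} (λ j j<1+r →
             product-lower j (r ∸ j) (split (ℕ.≤-pred j<1+r)) (ih (s≤s (ℕ.m∸n≤m r j))) n)) ⟩
      1/suc r * weighted (suc r) (λ k → (C k *S F (suc r ∸ k)) n)
        ≡⟨ F-unfold r n ⟨
      F (suc r) n
      ∎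
      where
      open ≤-Reasoning
      x = X (suc r) n
      y = Y (suc r) n
      A B : ℕ → ℚ
      A k = c k 0 * f (suc r ∸ k)
      B k = c k 0 * g (suc r ∸ k) + (- c k 1) * f (suc r ∸ k)
      factor : ∀ i a b x y → (i * a) * x - (i * b) * y ≡ i * (a * x - b * y)
      factor = solve-∀ ℚ-ring

open import Data.Nat using (ℕ; suc; _≤_; _∸_; _⊓_; _*_; _+_)
open import Data.Integer using (+_) renaming (_-_ to _-ℤ_)
open import Data.Rational using (ℚ; 0ℚ; 1ℚ; ½; _<_; -_) renaming (_*_ to _*ℚ_; _+_ to _+ℚ_)
open import Data.Product using (∃; _×_; _,_)

lemma2p2p2 :
    (Cnt : ℕ → ℕ → ℕ) →
    (∀ k m → IsConnectedGraphCount (Cnt k m) k m) →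
    (c : ℕ → ℕ → ℚ) →
    (∀ ℓ → 1 ≤ ℓ →
      Cser Cnt ℓ ≈S ΣS (3 * ℓ + 3) (λ d → c ℓ d ·S negPow (+ (3 * ℓ) -ℤ + d))) →
    (∀ ℓ → 1 ≤ ℓ → 0ℚ < c ℓ 0) →
    (∀ ℓ → 1 ≤ ℓ → 0ℚ < - c ℓ 1) →
    (∀ ℓ → 1 ≤ ℓ →
      ((c ℓ 0 ·S negPow (+ (3 * ℓ))) -S ((- c ℓ 1) ·S negPow (+ (3 * ℓ) -ℤ + 1)))
        ≤c Cser Cnt ℓ) →
    (∀ ℓ → 1 ≤ ℓ → Cser Cnt ℓ ≤c (c ℓ 0 ·S negPow (+ (3 * ℓ)))) →
    (L : ℕ) → 1 ≤ L →
    (F : ℕ → PS) →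
    F 0 ≈S oneS →
    (∀ r → 1 ≤ r →
      (nat r ·S F r)
        ≈S (½ ·S ΣS1to (r ⊓ L) (λ k → nat k ·S (Cser Cnt k *S F (r ∸ k))))) →
    ∃ λ (f : ℕ → ℕ → ℚ) →
        (∀ r → F r ≈S ΣS (5 * r + 1) (λ d → f r d ·S negPow (+ (3 * r) -ℤ + d)))
      × (∀ r → ((f r 0 ·S negPow (+ (3 * r))) -S ((- f r 1) ·S negPow (+ (3 * r) -ℤ + 1)))
                 ≤c F r)
      × (∀ r → F r ≤c (f r 0 ·S negPow (+ (3 * r))))
      × f 0 0 ≡ 1ℚ
      × - f 0 1 ≡ 0ℚ
      × (∀ r → 1 ≤ r →
           nat r *ℚ f r 0 ≡ ½ *ℚ Σ1to (r ⊓ L) (λ k → nat k *ℚ (c k 0 *ℚ f (r ∸ k) 0)))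
      × (∀ r → 1 ≤ r →
           nat r *ℚ (- f r 1)
             ≡ (½ *ℚ Σ1to (r ⊓ L) (λ k → nat k *ℚ (c k 0 *ℚ (- f (r ∸ k) 1))))
               +ℚ (½ *ℚ Σ1to (r ⊓ L) (λ k → nat k *ℚ ((- c k 1) *ℚ f (r ∸ k) 0))))
      × (∀ r → 1 ≤ r → 0ℚ < f r 0)
      × (∀ r → 1 ≤ r → 0ℚ < - f r 1)
lemma2p2p2 Cnt _ c C-expansion c-pos d-pos C-lower C-upper L 1≤L F F-zero F-rec =
    coeff
  , (λ r n → trans (F-expansion r n)
                   (cong (λ N → Expansions.expansion (+ (3 * r)) N (coeff r) n) (ℕ.+-comm 1 (5 * r))))
  , F-lower
  , F-upper
  , refl
  , refl
  , (λ { (suc r) _ → f-rec r })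
  , (λ { (suc r) _ → g-rec r })
  , (λ { (suc r) _ → f-pos (suc r) })
  , (λ { (suc r) _ → g-pos r })
  where
  open WrightRecurrence Cnt c C-expansion c-pos d-pos C-lower C-upper L 1≤L F F-zero F-rec
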